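{- Let $\varphi=\frac{1+\sqrt5}{2}$, let $F=0100101001001010010\ldots$ be the Fibonacci word (the cutting sequence of the line $y=\varphi x$), and let $S^M=01020101020102010102\ldots$ be the ternary word obtained from $F$ by replacing every factor $00$ by $020$. Then for every integer $n>0$, $C(S^M,n)=n+2$.
   Context: The cutting sequence of a line $y=\lambda x$ ($\lambda>0$) is the binary word obtained by following the line from the origin and writing $0$ for each meeting with a horizontal grid line $y=k$ and $1$ for each meeting with a vertical grid line $x=k$ ($k$ a positive integer). A factor of an infinite word $x=x_1x_2\ldots$ is a finite word $x_ix_{i+1}\cdots x_j$ ($i\le j$). For $n\in\mathbb{N}$, $C(x,n)$ denotes the number of distinct factors of $x$ of length $n$. -}

module Defs where

open import Data.Nat using (ℕ; zero; suc; _+_; _*_; _∸_; _<ᵇ_; _≡ᵇ_)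
open import Data.Bool using (Bool; true; false; if_then_else_)
open import Data.Fin using (Fin; toℕ) renaming (zero to f0; suc to fs)
open import Data.List using (List; length; filterᵇ; applyUpTo)
open import Data.Bool.ListAction using (any)
open import Data.Vec using (Vec; lookup)
open import Data.Product using (Σ; ∃; _×_)
open import Data.List.Membership.Propositional using (_∈_)
open import Data.List.Relation.Unary.Unique.Propositional using (Unique)
open import Relation.Binary.PropositionalEquality using (_≡_)

Word : Set → Set
Word A = ℕ → A

IsFactor : {A : Set} {n : ℕ} → Word A → Vec A n → Set
IsFactor {n = n} x w = ∃ λ i → (j : Fin n) → x (i + toℕ j) ≡ lookup w j

Complexity : {A : Set} → Word A → ℕ → ℕ → Set
Complexity {A} x n c =
  Σ (List (Vec A n)) λ L →
    (length L ≡ c) × Unique L × ((w : Vec A n) → (IsFactor x w → w ∈ L) × (w ∈ L → IsFactor x w))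

-- Cutting sequence of y = φ x, φ = (1+√5)/2, computed exactly in ℕ.
-- For k ≥ 1 and m ≥ 1:  m < kφ  ⇔  2m - k < k√5  ⇔  (2m ∸ k)² < 5k².
-- (No crossing is simultaneous since φ is irrational.)

ltPhi : ℕ → ℕ → Bool
ltPhi m k = ((2 * m ∸ k) * (2 * m ∸ k)) <ᵇ (5 * (k * k))

-- number of horizontal lines y = m (m ≥ 1) crossed before the vertical
-- line x = k (k ≥ 1), i.e. #{m ≥ 1 : m < kφ}  (all such m are < 2k).
below : ℕ → ℕ
below k = length (filterᵇ (λ m → ltPhi m k) (applyUpTo suc (2 * k)))

-- The crossing with x = k is the (k-1 + below k)-th letter (0-indexed);
-- all other letters are crossings with horizontal lines.  Since that
-- position is ≥ k-1, only k ≤ p+1 need be checked for position p.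
fibonacciWord : Word (Fin 2)
fibonacciWord p =
  if any (λ k → p ≡ᵇ (k ∸ 1 + below k)) (applyUpTo suc (suc p))
  then fs f0 else f0

-- S^M : replace every factor 00 of F by 020, i.e. each letter 0 that is
-- followed by a 0 becomes the block 02; every other letter a becomes a.

data Block (A : Set) : Set where
  one : A → Block A
  two : A → A → Block A

flatten : {A : Set} → (ℕ → Block A) → Word A
flatten f q with f 0
flatten f zero          | one a   = a
flatten f (suc q)       | one a   = flatten (λ i → f (suc i)) q
flatten f zero          | two a b = a
flatten f (suc zero)    | two a b = b
flatten f (suc (suc q)) | two a b = flatten (λ i → f (suc i)) q

embed : Fin 2 → Fin 3
embed f0 = f0
embed (fs f0) = fs f0

blockM : Fin 2 → Fin 2 → Block (Fin 3)
blockM f0 f0 = two f0 (fs (fs f0))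
blockM a  b  = one (embed a)

SM : Word (Fin 3)
SM = flatten (λ i → blockM (fibonacciWord i) (fibonacciWord (suc i)))

-- S^M interleaves a separator with the Fibonacci word F. F is the fixed point of the morphism
-- σ : 0 ↦ 01, 1 ↦ 0, and replacing 00 by 020 turns each block σ (F k) of F into 0 (F k + 1),
-- so S^M = 0 F₀′ 0 F₁′ 0 F₂′ … with a′ = a + 1. A factor of S^M is thus determined by the
-- parity of its position and a factor of F, so C(S^M, 2h) = 2 C(F, h) and
-- C(S^M, 2h + 1) = C(F, h) + C(F, h + 1). As a fixed point of σ, F is Sturmian:
-- desubstitution shows that its left special factors are its prefixes, so C(F, h) = h + 1.
-- That F is fixed by σ comes from its Beatty description: with a(k) = ⌊kφ⌋, F has its 1s just
-- before the positions k + a(k), and a(k + 1) − a(k) = |σ (F (k − 1))|. These facts reduce to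
-- inequalities t² ≶ tk + k², handled by the symmetries of φ under x ↦ 1 + 1/x.
module Submission where

open import Defs
open import Data.Nat using (ℕ; zero; suc; _+_; _*_; _∸_; _≤_; _<_; _≤′_; ≤′-refl; ≤′-step; z≤n; s≤s; _<?_; _≤?_; _≡ᵇ_)
open import Data.Nat.Properties
open import Data.Nat.Induction using (<-rec)
open import Data.Nat.Tactic.RingSolver using (solve-∀)
open import Data.Bool using (Bool; true; false; T)
open import Data.Bool.ListAction using (any)
open import Data.Empty using (⊥-elim)
open import Data.Unit using (⊤; tt)
open import Data.Sum using (_⊎_; inj₁; inj₂)
open import Data.Product using (Σ-syntax; ∃; _×_; _,_; proj₁; proj₂)
open import Data.Fin using (Fin; toℕ) renaming (zero to f0; suc to fs)
import Data.Fin.Properties as Fin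
open import Data.List using (List; []; _∷_; length; map; filter; filterᵇ; applyUpTo; _++_; concatMap)
open import Data.List.Properties using (length-map; length-++; filter-reject; filter-all)
open import Data.List.Membership.Propositional using (_∈_)
open import Data.List.Membership.Propositional.Properties using (∈-map⁺; ∈-map⁻; ∈-filter⁺; ∈-++⁺ˡ; ∈-++⁺ʳ; ∈-++⁻)
import Data.List.Relation.Unary.Unique.Propositional.Properties as Unique
open import Data.List.Relation.Unary.All as All using (All; []; _∷_)
open import Data.List.Relation.Unary.All.Properties using (all-filter)
open import Data.List.Relation.Unary.AllPairs as AllPairs using (AllPairs; []; _∷_)
import Data.List.Relation.Unary.AllPairs.Properties as AllPairs
open import Data.List.Relation.Unary.Any using (here; there)
open import Data.List.Relation.Unary.Any.Properties using (any⁺; any⁻; applyUpTo⁺; applyUpTo⁻)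
open import Data.Vec using (Vec; []; _∷_; toList; lookup; tabulate)
open import Data.Vec.Properties using (length-toList; tabulate∘lookup; tabulate-cong; ∷-injectiveˡ; ∷-injectiveʳ; ≡-dec)
open import Function using (id; _∘_)
open import Algebra.Properties.CommutativeSemigroup +-commutativeSemigroup using (x∙yz≈y∙xz)
open import Relation.Nullary using (¬_; yes; no; ¬?)
open import Relation.Nullary.Decidable using (map′)
open import Relation.Unary using (Decidable)
open import Relation.Binary using (DecidableEquality; tri<; tri≈; tri>)
open import Relation.Binary.PropositionalEquality

window : {A : Set} → Word A → ℕ → (n : ℕ) → Vec A n
window x p zero = []
window x p (suc n) = x p ∷ window x (suc p) n

Occurs : {A : Set} → Word A → ℕ → List A → Set
Occurs x p [] = ⊤
Occurs x p (a ∷ w) = x p ≡ a × Occurs x (suc p) w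

module _ {A : Set} (x : Word A) where

  window-lookup : ∀ p {n} (j : Fin n) → lookup (window x p n) j ≡ x (p + toℕ j)
  window-lookup p f0 = cong x (sym (+-identityʳ p))
  window-lookup p (fs j) = trans (window-lookup (suc p) j) (cong x (sym (+-suc p (toℕ j))))

  window-IsFactor : ∀ p n → IsFactor x (window x p n)
  window-IsFactor p n = p , λ j → sym (window-lookup p j)

  IsFactor⇒window : ∀ {n} (w : Vec A n) → IsFactor x w → ∃ λ p → w ≡ window x p n
  IsFactor⇒window {n} w (p , occ) = p , (begin
    w                                ≡⟨ tabulate∘lookup w ⟨
    tabulate (lookup w)              ≡⟨ tabulate-cong (λ j → trans (sym (occ j)) (sym (window-lookup p j))) ⟩
    tabulate (lookup (window x p n)) ≡⟨ tabulate∘lookup (window x p n) ⟩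
    window x p n                     ∎)
    where open ≡-Reasoning

  Occurs-window : ∀ p n → Occurs x p (toList (window x p n))
  Occurs-window p zero = tt
  Occurs-window p (suc n) = refl , Occurs-window (suc p) n

  Occurs⇒≡window : ∀ p {n} (w : Vec A n) → Occurs x p (toList w) → w ≡ window x p n
  Occurs⇒≡window p [] tt = refl
  Occurs⇒≡window p (a ∷ w) (refl , occ) = cong (x p ∷_) (Occurs⇒≡window (suc p) w occ)

  Occurs⇒≡windowˡ : ∀ p (w : List A) → Occurs x p w → w ≡ toList (window x p (length w))
  Occurs⇒≡windowˡ p [] tt = refl
  Occurs⇒≡windowˡ p (a ∷ w) (refl , occ) = cong (x p ∷_) (Occurs⇒≡windowˡ (suc p) w occ)

  Occurs-window-prefix : ∀ {p} q {m n} → m ≤ n →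
    Occurs x p (toList (window x q n)) → Occurs x p (toList (window x q m))
  Occurs-window-prefix q z≤n occ = tt
  Occurs-window-prefix q (s≤s m≤n) (e , occ) = e , Occurs-window-prefix (suc q) m≤n occ

  Occurs-shift : ∀ n p w → Occurs x (n + p) w → Occurs (λ i → x (n + i)) p w
  Occurs-shift n p [] _ = tt
  Occurs-shift n p (a ∷ w) (e , occ) =
    e , Occurs-shift n (suc p) w (subst (λ r → Occurs x r w) (sym (+-suc n p)) occ)

module _ {A : Set} {x y : Word A} (x≗y : ∀ i → x i ≡ y i) where

  IsFactor-cong : ∀ {n} {w : Vec A n} → IsFactor x w → IsFactor y w
  IsFactor-cong (i , occ) = i , λ j → trans (sym (x≗y _)) (occ j)

  Complexity-cong : ∀ {n c} → Complexity x n c → Complexity y n c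
  Complexity-cong (L , len , unique , factors) =
    L , len , unique , λ w →
      (λ fac → proj₁ (factors w) (IsFactor-cong-sym {w = w} fac)) ,
      (λ w∈ → IsFactor-cong {w = w} (proj₂ (factors w) w∈))
    where
    IsFactor-cong-sym : ∀ {n} {w : Vec A n} → IsFactor y w → IsFactor x w
    IsFactor-cong-sym (i , occ) = i , λ j → trans (x≗y _) (occ j)

length-filter-≢ : {A B : Set} (f : A → B) (_≟_ : DecidableEquality B) {c : B} (xs : List A) →
  AllPairs (λ r s → f r ≢ f s) xs → (∃ λ r → r ∈ xs × f r ≡ c) →
  suc (length (filter (λ r → ¬? (f r ≟ c)) xs)) ≡ length xs
length-filter-≢ f _≟_ {c} (y ∷ ys) (fy≢ ∷ distinct) (r , here refl , fy≡c) =
  cong (suc ∘ length) (trans (filter-reject (λ r → ¬? (f r ≟ c)) (λ ne → ne fy≡c))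
    (filter-all (λ r → ¬? (f r ≟ c)) (All.map (λ fy≢fs fs≡c → fy≢fs (trans fy≡c (sym fs≡c))) fy≢)))
length-filter-≢ f _≟_ {c} (y ∷ ys) (fy≢ ∷ distinct) (r , there r∈ , fr≡c) with f y ≟ c
... | yes fy≡c = ⊥-elim (All.lookup fy≢ r∈ (trans fy≡c (sym fr≡c)))
... | no _ = cong suc (length-filter-≢ f _≟_ ys distinct (r , r∈ , fr≡c))

module _ {A : Set} (x : Word A) where

  record Enumeration (n : ℕ) (start : ℕ → ℕ) : Set where
    field
      indices  : List ℕ
      distinct : AllPairs (λ r s → window x (start r) n ≢ window x (start s) n) indices
      complete : ∀ p → ∃ λ r → r ∈ indices × window x p n ≡ window x (start r) n

  Enumeration⇒Complexity : ∀ {n start} (e : Enumeration n start) →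
    Complexity x n (length (Enumeration.indices e))
  Enumeration⇒Complexity {n} {start} e =
    map factor indices , length-map factor indices , AllPairs.map⁺ distinct ,
    λ w → listed w , occurs w
    where
    open Enumeration e
    factor : ℕ → Vec A n
    factor r = window x (start r) n
    listed : ∀ w → IsFactor x w → w ∈ map factor indices
    listed w fac with IsFactor⇒window x w fac
    ... | p , refl with complete p
    ...   | r , r∈ , eq = subst (_∈ map factor indices) (sym eq) (∈-map⁺ factor r∈)
    occurs : ∀ w → w ∈ map factor indices → IsFactor x w
    occurs w w∈ with ∈-map⁻ factor w∈
    ... | r , _ , refl = window-IsFactor x (start r) n

  -- Windows starting at positive positions can be extended to the left; this re-indexing
  -- needs the prefix, the one window that may only occur at position 0, to recur.
  Enumeration-shift : ∀ {n} → (∃ λ q → window x (suc q) n ≡ window x 0 n) → (e : Enumeration n id) →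
    Σ[ e′ ∈ Enumeration n suc ] length (Enumeration.indices e′) ≡ length (Enumeration.indices e)
  Enumeration-shift {n} (q , recurs) e =
    record { indices = map previous indices ; distinct = distinct′ ; complete = complete′ } ,
    length-map previous indices
    where
    open Enumeration e
    previous : ℕ → ℕ
    previous zero = q
    previous (suc r) = r
    window-previous : ∀ r → window x (suc (previous r)) n ≡ window x r n
    window-previous zero = recurs
    window-previous (suc r) = refl
    distinct′ : AllPairs (λ r s → window x (suc r) n ≢ window x (suc s) n) (map previous indices)
    distinct′ = AllPairs.map⁺ (AllPairs.map
      (λ {r} {s} ne eq → ne (trans (sym (window-previous r)) (trans eq (window-previous s)))) distinct)
    complete′ : ∀ p → ∃ λ r → r ∈ map previous indices × window x p n ≡ window x (suc r) n
    complete′ p with complete p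
    ... | r , r∈ , eq = previous r , ∈-map⁺ previous r∈ , trans eq (sym (window-previous r))

Fin2-≢-≢⇒≡ : ∀ {a b c : Fin 2} → a ≢ b → a ≢ c → b ≡ c
Fin2-≢-≢⇒≡ {f0} {f0} a≢b _ = ⊥-elim (a≢b refl)
Fin2-≢-≢⇒≡ {f0} {fs f0} {f0} _ a≢c = ⊥-elim (a≢c refl)
Fin2-≢-≢⇒≡ {f0} {fs f0} {fs f0} _ _ = refl
Fin2-≢-≢⇒≡ {fs f0} {f0} {f0} _ _ = refl
Fin2-≢-≢⇒≡ {fs f0} {f0} {fs f0} _ a≢c = ⊥-elim (a≢c refl)
Fin2-≢-≢⇒≡ {fs f0} {fs f0} a≢b _ = ⊥-elim (a≢b refl)

_≟ᵛ_ : ∀ {n} → DecidableEquality (Vec (Fin 2) n)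
_≟ᵛ_ = ≡-dec Fin._≟_

module _ (x : Word (Fin 2)) where

  LeftSpecial : ∀ {n} → Vec (Fin 2) n → Set
  LeftSpecial {n} w = ∀ a → ∃ λ p → window x p (suc n) ≡ a ∷ w

  distinct-extensions⇒LeftSpecial : ∀ {h} p q → window x (suc p) h ≡ window x (suc q) h → x p ≢ x q →
    LeftSpecial (window x (suc p) h)
  distinct-extensions⇒LeftSpecial p q same differ a with x p Fin.≟ a
  ... | yes refl = p , refl
  ... | no xp≢a = q , cong₂ _∷_ (Fin2-≢-≢⇒≡ differ xp≢a) (sym same)

  -- Each factor of length h has one left extension, except the prefix, the only left special
  -- factor, which has two.
  extend-left : ∀ {h} (e : Enumeration x h suc) →
    (∀ {w} → LeftSpecial w → w ≡ window x 0 h) → LeftSpecial (window x 0 h) →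
    Σ[ e′ ∈ Enumeration x (suc h) id ] length (Enumeration.indices e′) ≡ suc (length (Enumeration.indices e))
  extend-left {h} e unique special =
    record { indices = p₀ ∷ p₁ ∷ kept ; distinct = distinct′ ; complete = complete′ } ,
    cong suc (length-filter-≢ (λ r → window x (suc r) h) _≟ᵛ_ indices distinct prefix-listed)
    where
    open Enumeration e
    P = window x 0 h
    p₀ = proj₁ (special f0)
    p₁ = proj₁ (special (fs f0))
    w₀ : window x p₀ (suc h) ≡ f0 ∷ P
    w₀ = proj₂ (special f0)
    w₁ : window x p₁ (suc h) ≡ fs f0 ∷ P
    w₁ = proj₂ (special (fs f0))
    prefix-listed : ∃ λ r → r ∈ indices × window x (suc r) h ≡ P
    prefix-listed with complete 0
    ... | r , r∈ , eq = r , r∈ , sym eq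
    kept = filter (λ r → ¬? (window x (suc r) h ≟ᵛ P)) indices
    kept-non-prefix : All (λ r → window x (suc r) h ≢ P) kept
    kept-non-prefix = all-filter (λ r → ¬? (window x (suc r) h ≟ᵛ P)) indices
    differs-from-kept : ∀ {a p} → window x p (suc h) ≡ a ∷ P →
      All (λ s → window x p (suc h) ≢ window x s (suc h)) kept
    differs-from-kept wp = All.map (λ ne eq → ne (∷-injectiveʳ (trans (sym eq) wp))) kept-non-prefix
    distinct′ : AllPairs (λ r s → window x r (suc h) ≢ window x s (suc h)) (p₀ ∷ p₁ ∷ kept)
    distinct′ =
      ((λ eq → Fin.0≢1+n (∷-injectiveˡ (trans (sym w₀) (trans eq w₁)))) ∷ differs-from-kept w₀) ∷
      differs-from-kept w₁ ∷
      AllPairs.map (λ ne eq → ne (∷-injectiveʳ eq))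
        (AllPairs.filter⁺ (λ r → ¬? (window x (suc r) h ≟ᵛ P)) distinct)
    complete′ : ∀ q → ∃ λ r → r ∈ p₀ ∷ p₁ ∷ kept × window x q (suc h) ≡ window x r (suc h)
    complete′ q with complete (suc q)
    ... | r , r∈ , eq with window x (suc r) h ≟ᵛ P
    ...   | no ≢P = r , there (there (∈-filter⁺ _ r∈ ≢P)) , cong₂ _∷_ same-letter eq
      where
      same-letter : x q ≡ x r
      same-letter with x q Fin.≟ x r
      ... | yes eqq = eqq
      ... | no differ = ⊥-elim (≢P (trans (sym eq) (unique (distinct-extensions⇒LeftSpecial q r eq differ))))
    ...   | yes ≡P with x q
    ...     | f0 = p₀ , here refl , trans (cong (f0 ∷_) (trans eq ≡P)) (sym w₀)
    ...     | fs f0 = p₁ , there (here refl) , trans (cong (fs f0 ∷_) (trans eq ≡P)) (sym w₁)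

σ : Fin 2 → List (Fin 2)
σ f0 = f0 ∷ fs f0 ∷ []
σ (fs _) = f0 ∷ []

σ-start : Word (Fin 2) → ℕ → ℕ
σ-start y zero = 0
σ-start y (suc k) = length (σ (y k)) + σ-start y k

σ-Image : Word (Fin 2) → Word (Fin 2) → Set
σ-Image x y = ∀ k → Occurs x (σ-start y k) (σ (y k))

σ-start-suc-0 : ∀ y k → y k ≡ f0 → σ-start y (suc k) ≡ suc (suc (σ-start y k))
σ-start-suc-0 y k yk = cong (λ a → length (σ a) + σ-start y k) yk

σ-start-suc-1 : ∀ y k → y k ≡ fs f0 → σ-start y (suc k) ≡ suc (σ-start y k)
σ-start-suc-1 y k yk = cong (λ a → length (σ a) + σ-start y k) yk

σ-start-shift : ∀ y k → σ-start y (suc k) ≡ length (σ (y 0)) + σ-start (y ∘ suc) k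
σ-start-shift y zero = refl
σ-start-shift y (suc k) =
  trans (cong (length (σ (y (suc k))) +_) (σ-start-shift y k))
    (x∙yz≈y∙xz (length (σ (y (suc k)))) (length (σ (y 0))) (σ-start (y ∘ suc) k))

σ-Image-tail : ∀ {x y} → σ-Image x y → σ-Image (λ i → x (length (σ (y 0)) + i)) (y ∘ suc)
σ-Image-tail {x} {y} image k =
  Occurs-shift x (length (σ (y 0))) (σ-start (y ∘ suc) k) (σ (y (suc k)))
    (subst (λ p → Occurs x p (σ (y (suc k)))) (σ-start-shift y k) (image (suc k)))

σ-head : ∀ {x : Word (Fin 2)} {p} a → Occurs x p (σ a) → x p ≡ f0
σ-head f0 (e , _) = e
σ-head (fs f0) (e , _) = e

length-concatMap-σ : ∀ w → length w ≤ length (concatMap σ w)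
length-concatMap-σ [] = z≤n
length-concatMap-σ (f0 ∷ w) = s≤s (m≤n⇒m≤1+n (length-concatMap-σ w))
length-concatMap-σ (fs f0 ∷ w) = s≤s (length-concatMap-σ w)

-- Desubstitution of a word read from the start of a block: a final 0, which may be a truncated
-- σ 0, is dropped, and a 1 in the place of a block start ends the word.
σ⁻¹ : List (Fin 2) → List (Fin 2)
σ⁻¹ [] = []
σ⁻¹ (f0 ∷ []) = []
σ⁻¹ (f0 ∷ fs f0 ∷ w) = f0 ∷ σ⁻¹ w
σ⁻¹ (f0 ∷ w@(f0 ∷ _)) = fs f0 ∷ σ⁻¹ w
σ⁻¹ (fs _ ∷ w) = []

length-σ⁻¹ : ∀ w → length (σ⁻¹ w) ≤ length w
length-σ⁻¹-∷ : ∀ a w → length (σ⁻¹ (a ∷ w)) ≤ length w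
length-σ⁻¹ [] = z≤n
length-σ⁻¹ (a ∷ w) = m≤n⇒m≤1+n (length-σ⁻¹-∷ a w)
length-σ⁻¹-∷ f0 [] = z≤n
length-σ⁻¹-∷ f0 (fs f0 ∷ w) = s≤s (length-σ⁻¹ w)
length-σ⁻¹-∷ f0 (f0 ∷ w) = s≤s (length-σ⁻¹-∷ f0 w)
length-σ⁻¹-∷ (fs f0) w = z≤n

-- Fixed points of σ are Sturmian

module _ (x : Word (Fin 2)) (fixed : σ-Image x x) where

  private
    start : ℕ → ℕ
    start = σ-start x

  at-start≡0 : ∀ k → x (start k) ≡ f0
  at-start≡0 k = σ-head (x k) (fixed k)

  after-start≡1 : ∀ k → x k ≡ f0 → x (suc (start k)) ≡ fs f0
  after-start≡1 k xk = proj₁ (proj₂ (subst (λ a → Occurs x (start k) (σ a)) xk (fixed k)))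

  after-start≡0⇒1 : ∀ k → x (suc (start k)) ≡ f0 → x k ≡ fs f0
  after-start≡0⇒1 k e with x k in xk
  ... | f0 = ⊥-elim (Fin.0≢1+n (trans (sym e) (after-start≡1 k xk)))
  ... | fs f0 = refl

  after-start≡1⇒0 : ∀ k → x (suc (start k)) ≡ fs f0 → x k ≡ f0
  after-start≡1⇒0 k e with x k in xk
  ... | f0 = refl
  ... | fs f0 = ⊥-elim (Fin.0≢1+n (trans (sym x₁) e))
    where
    x₁ : x (suc (start k)) ≡ f0
    x₁ = subst (λ p → x p ≡ f0) (σ-start-suc-1 x k xk) (at-start≡0 (suc k))

  start-cover : ∀ p → (∃ λ k → p ≡ start k) ⊎ (∃ λ k → p ≡ suc (start k) × x k ≡ f0)
  start-cover zero = inj₁ (0 , refl)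
  start-cover (suc p) with start-cover p
  ... | inj₂ (k , refl , xk) = inj₁ (suc k , sym (σ-start-suc-0 x k xk))
  ... | inj₁ (k , refl) with x k in xk
  ...   | f0 = inj₂ (k , refl , xk)
  ...   | fs f0 = inj₁ (suc k , sym (σ-start-suc-1 x k xk))

  ≡0⇒at-start : ∀ p → x p ≡ f0 → ∃ λ k → p ≡ start k
  ≡0⇒at-start p xp with start-cover p
  ... | inj₁ at = at
  ... | inj₂ (k , refl , xk) = ⊥-elim (Fin.0≢1+n (trans (sym xp) (after-start≡1 k xk)))

  ≡1⇒after-start : ∀ p → x p ≡ fs f0 → ∃ λ k → p ≡ suc (start k) × x k ≡ f0
  ≡1⇒after-start p xp with start-cover p
  ... | inj₁ (k , refl) = ⊥-elim (Fin.0≢1+n (trans (sym (at-start≡0 k)) xp))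
  ... | inj₂ after = after

  no-11 : ∀ p → x p ≡ fs f0 → x (suc p) ≡ f0
  no-11 p xp with ≡1⇒after-start p xp
  ... | k , refl , xk = subst (λ q → x q ≡ f0) (σ-start-suc-0 x k xk) (at-start≡0 (suc k))

  starts-0100 : x 0 ≡ f0 × x 1 ≡ fs f0 × x 2 ≡ f0 × x 3 ≡ f0
  starts-0100 = x₀ , x₁ , x₂ ,
    subst (λ p → x p ≡ f0) (trans (σ-start-suc-1 x 1 x₁) (cong suc (σ-start-suc-0 x 0 x₀))) (at-start≡0 2)
    where
    x₀ = at-start≡0 0
    x₁ = after-start≡1 0 x₀
    x₂ = subst (λ p → x p ≡ f0) (σ-start-suc-0 x 0 x₀) (at-start≡0 1)

  Occurs-σ : ∀ m w → Occurs x m w → Occurs x (start m) (concatMap σ w)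
  Occurs-σ m [] tt = tt
  Occurs-σ m (f0 ∷ w) (xm , occ) =
    at-start≡0 m , after-start≡1 m xm ,
    subst (λ p → Occurs x p (concatMap σ w)) (σ-start-suc-0 x m xm) (Occurs-σ (suc m) w occ)
  Occurs-σ m (fs f0 ∷ w) (xm , occ) =
    at-start≡0 m , subst (λ p → Occurs x p (concatMap σ w)) (σ-start-suc-1 x m xm) (Occurs-σ (suc m) w occ)

  Occurs-σ⁻¹ : ∀ m w → Occurs x (start m) w → Occurs x m (σ⁻¹ w)
  Occurs-σ⁻¹ m [] occ = tt
  Occurs-σ⁻¹ m (f0 ∷ []) occ = tt
  Occurs-σ⁻¹ m (f0 ∷ fs f0 ∷ w) (_ , x₁ , occ) =
    xm , Occurs-σ⁻¹ (suc m) w (subst (λ p → Occurs x p w) (sym (σ-start-suc-0 x m xm)) occ)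
    where xm = after-start≡1⇒0 m x₁
  Occurs-σ⁻¹ m (f0 ∷ f0 ∷ w) (_ , x₁ , occ) =
    xm , Occurs-σ⁻¹ (suc m) (f0 ∷ w)
      (subst (λ p → Occurs x p (f0 ∷ w)) (sym (σ-start-suc-1 x m xm)) (x₁ , occ))
    where xm = after-start≡0⇒1 m x₁
  Occurs-σ⁻¹ m (fs f0 ∷ w) (x₀ , _) = ⊥-elim (Fin.0≢1+n (trans (sym (at-start≡0 m)) x₀))

  Occurs-σ⁻¹-reflect : ∀ m m′ w → Occurs x (start m) w → Occurs x m′ (σ⁻¹ w) → Occurs x (start m′) w
  Occurs-σ⁻¹-reflect m m′ [] _ _ = tt
  Occurs-σ⁻¹-reflect m m′ (f0 ∷ []) _ _ = at-start≡0 m′ , tt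
  Occurs-σ⁻¹-reflect m m′ (f0 ∷ fs f0 ∷ w) (_ , x₁ , occ) (xm′ , occ′) =
    at-start≡0 m′ , after-start≡1 m′ xm′ ,
    subst (λ p → Occurs x p w) (σ-start-suc-0 x m′ xm′)
      (Occurs-σ⁻¹-reflect (suc m) (suc m′) w (subst (λ p → Occurs x p w) (sym (σ-start-suc-0 x m xm)) occ) occ′)
    where xm = after-start≡1⇒0 m x₁
  Occurs-σ⁻¹-reflect m m′ (f0 ∷ f0 ∷ w) (_ , x₁ , occ) (xm′ , occ′) =
    at-start≡0 m′ ,
    subst (λ p → Occurs x p (f0 ∷ w)) (σ-start-suc-1 x m′ xm′)
      (Occurs-σ⁻¹-reflect (suc m) (suc m′) (f0 ∷ w)
        (subst (λ p → Occurs x p (f0 ∷ w)) (sym (σ-start-suc-1 x m xm)) (x₁ , occ)) occ′)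
    where xm = after-start≡0⇒1 m x₁
  Occurs-σ⁻¹-reflect m m′ (fs f0 ∷ w) (x₀ , _) _ = ⊥-elim (Fin.0≢1+n (trans (sym (at-start≡0 m)) x₀))

  -- Both occurrences of c ∷ w begin at block starts, after blocks coming from a 0 and from a 1,
  -- so σ⁻¹ (c ∷ w) is a shorter left special factor; it is a prefix by induction, hence so is c ∷ w.
  special⇒prefix : ∀ w {p q} → Occurs x p (f0 ∷ w) → Occurs x q (fs f0 ∷ w) → Occurs x 0 w
  special⇒prefix w = descend (length w) w ≤-refl
    where
    descend : ∀ n w {p q} → length w ≤ n → Occurs x p (f0 ∷ w) → Occurs x q (fs f0 ∷ w) → Occurs x 0 w
    descend _ [] _ _ _ = tt
    descend zero (c ∷ w) () _ _
    descend (suc n) (c ∷ w) {p} {q} (s≤s |w|≤n) (xp , occ₀) (xq , occ₁)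
      with ≡1⇒after-start q xq | ≡0⇒at-start p xp
    ... | k , refl , xk | k′ , refl =
      Occurs-σ⁻¹-reflect (suc k) 0 (c ∷ w) at-k
        (descend n (σ⁻¹ (c ∷ w)) (≤-trans (length-σ⁻¹-∷ c w) |w|≤n)
          (xk , Occurs-σ⁻¹ (suc k) (c ∷ w) at-k) (xk′ , Occurs-σ⁻¹ (suc k′) (c ∷ w) at-k′))
      where
      c≡0 : c ≡ f0
      c≡0 = trans (sym (proj₁ occ₁)) (no-11 (suc (start k)) xq)
      xk′ : x k′ ≡ fs f0
      xk′ = after-start≡0⇒1 k′ (trans (proj₁ occ₀) c≡0)
      at-k : Occurs x (start (suc k)) (c ∷ w)
      at-k = subst (λ r → Occurs x r (c ∷ w)) (sym (σ-start-suc-0 x k xk)) occ₁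
      at-k′ : Occurs x (start (suc k′)) (c ∷ w)
      at-k′ = subst (λ r → Occurs x r (c ∷ w)) (sym (σ-start-suc-1 x k′ xk′)) occ₀

  Occurs-σ-prefix : ∀ n {r} → Occurs x r (concatMap σ (toList (window x 0 (suc n)))) →
    Occurs x r (toList (window x 0 (suc (suc n))))
  Occurs-σ-prefix n occ = Occurs-window-prefix x 0 σW-long (subst (Occurs x _) σW-prefix occ)
    where
    W = toList (window x 0 (suc n))
    σW = concatMap σ W
    σW-prefix : σW ≡ toList (window x 0 (length σW))
    σW-prefix = Occurs⇒≡windowˡ x 0 σW (Occurs-σ 0 W (Occurs-window x 0 (suc n)))
    σW-long : suc (suc n) ≤ length σW
    σW-long = subst (λ a → suc (suc n) ≤ length (concatMap σ (a ∷ V))) (sym (proj₁ starts-0100))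
      (s≤s (s≤s (≤-trans (≤-reflexive (sym (length-toList (window x 1 n)))) (length-concatMap-σ V))))
      where V = toList (window x 1 n)

  prefix-extensions-suc : ∀ n →
    (∀ a → ∃ λ p → Occurs x p (a ∷ toList (window x 0 (suc n)))) →
    (∀ a → ∃ λ p → Occurs x p (a ∷ toList (window x 0 (suc (suc n)))))
  prefix-extensions-suc n extensions f0 with extensions (fs f0)
  ... | p , occ with Occurs-σ p (fs f0 ∷ _) occ
  ...   | x₀ , rest = start p , x₀ , Occurs-σ-prefix n rest
  prefix-extensions-suc n extensions (fs f0) with extensions f0
  ... | p , occ with Occurs-σ p (f0 ∷ _) occ
  ...   | _ , x₁ , rest = suc (start p) , x₁ , Occurs-σ-prefix n rest

  prefix-extensions : ∀ n a → ∃ λ p → Occurs x p (a ∷ toList (window x 0 n))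
  prefix-extensions 0 f0 = 0 , proj₁ starts-0100 , tt
  prefix-extensions 0 (fs f0) = 1 , proj₁ (proj₂ starts-0100) , tt
  prefix-extensions 1 f0 with starts-0100
  ... | x₀ , _ , x₂ , x₃ = 2 , x₂ , trans x₃ (sym x₀) , tt
  prefix-extensions 1 (fs f0) with starts-0100
  ... | x₀ , x₁ , x₂ , _ = 1 , x₁ , trans x₂ (sym x₀) , tt
  prefix-extensions (suc (suc n)) = prefix-extensions-suc n (prefix-extensions (suc n))

  prefix-LeftSpecial : ∀ n → LeftSpecial x (window x 0 n)
  prefix-LeftSpecial n a with prefix-extensions n a
  ... | p , occ = p , sym (Occurs⇒≡window x p (a ∷ window x 0 n) occ)

  LeftSpecial⇒prefix : ∀ {n} {w : Vec (Fin 2) n} → LeftSpecial x w → w ≡ window x 0 n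
  LeftSpecial⇒prefix {n} {w} special with special f0 | special (fs f0)
  ... | p , w₀ | q , w₁ = Occurs⇒≡window x 0 w (special⇒prefix (toList w) (at p w₀) (at q w₁))
    where
    at : ∀ {a} r → window x r (suc n) ≡ a ∷ w → Occurs x r (a ∷ toList w)
    at r eq = subst (λ v → Occurs x r (toList v)) eq (Occurs-window x r (suc n))

  prefix-recurs : ∀ n → ∃ λ q → window x (suc q) n ≡ window x 0 n
  prefix-recurs n with prefix-LeftSpecial n (fs f0)
  ... | q , eq = q , ∷-injectiveʳ eq

  σ-fixed-enumeration : ∀ h → Σ[ e ∈ Enumeration x h suc ] length (Enumeration.indices e) ≡ suc h
  σ-fixed-enumeration zero =
    record { indices = 0 ∷ [] ; distinct = [] ∷ [] ; complete = λ _ → 0 , here refl , refl } , refl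
  σ-fixed-enumeration (suc h) with σ-fixed-enumeration h
  ... | e , len with extend-left x e LeftSpecial⇒prefix (prefix-LeftSpecial h)
  ...   | e′ , len′ with Enumeration-shift x (prefix-recurs (suc h)) e′
  ...     | e″ , len″ = e″ , trans len″ (trans len′ (cong suc len))

  σ-fixed-complexity : ∀ h → Complexity x h (suc h)
  σ-fixed-complexity h with σ-fixed-enumeration h
  ... | e , len = subst (Complexity x h) len (Enumeration⇒Complexity x e)

-- Interleaving a word with a separator

double : ℕ → ℕ
double zero = zero
double (suc n) = suc (suc (double n))

+-double : ∀ n → suc n + suc n ≡ double n + 2
+-double zero = refl
+-double (suc n) = cong suc (trans (+-suc (suc n) (suc n)) (cong suc (+-double n)))

parity : ∀ p → (∃ λ k → p ≡ double k) ⊎ (∃ λ k → p ≡ suc (double k))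
parity zero = inj₁ (0 , refl)
parity (suc p) with parity p
... | inj₁ (k , refl) = inj₂ (k , refl)
... | inj₂ (k , refl) = inj₁ (suc k , refl)

interleave : {A B : Set} → B → (A → B) → Word A → Word B
interleave s c x zero = s
interleave s c x (suc zero) = c (x 0)
interleave s c x (suc (suc q)) = interleave s c (x ∘ suc) q

module _ {A B : Set} (s : B) (c : A → B) where

  interleave-double : ∀ (x : Word A) k → interleave s c x (double k) ≡ s
  interleave-double x zero = refl
  interleave-double x (suc k) = interleave-double (x ∘ suc) k

  interleave-suc-double : ∀ (x : Word A) k → interleave s c x (suc (double k)) ≡ c (x k)
  interleave-suc-double x zero = refl
  interleave-suc-double x (suc k) = interleave-suc-double (x ∘ suc) k

  even-factor odd-factor : ∀ {h} → Vec A h → Vec B (double h)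
  even-factor [] = []
  even-factor (a ∷ v) = s ∷ c a ∷ even-factor v
  odd-factor [] = []
  odd-factor (a ∷ v) = c a ∷ s ∷ odd-factor v

  odd-factor⁺ : ∀ {h} → Vec A (suc h) → Vec B (suc (double h))
  odd-factor⁺ (a ∷ v) = c a ∷ even-factor v

  window-interleave-even : ∀ (x : Word A) k h →
    window (interleave s c x) (double k) (double h) ≡ even-factor (window x k h)
  window-interleave-even x k zero = refl
  window-interleave-even x k (suc h) =
    cong₂ _∷_ (interleave-double x k)
      (cong₂ _∷_ (interleave-suc-double x k) (window-interleave-even x (suc k) h))

  window-interleave-odd : ∀ (x : Word A) k h →
    window (interleave s c x) (suc (double k)) (double h) ≡ odd-factor (window x k h)
  window-interleave-odd x k zero = refl
  window-interleave-odd x k (suc h) =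
    cong₂ _∷_ (interleave-suc-double x k)
      (cong₂ _∷_ (interleave-double x (suc k)) (window-interleave-odd x (suc k) h))

  module _ (c-injective : ∀ {a b} → c a ≡ c b → a ≡ b) (c≢s : ∀ a → c a ≢ s) where

    even-factor-injective : ∀ {h} {u v : Vec A h} → even-factor u ≡ even-factor v → u ≡ v
    even-factor-injective {u = []} {[]} _ = refl
    even-factor-injective {u = a ∷ u} {b ∷ v} eq =
      cong₂ _∷_ (c-injective (∷-injectiveˡ (∷-injectiveʳ eq)))
        (even-factor-injective (∷-injectiveʳ (∷-injectiveʳ eq)))

    odd-factor-injective : ∀ {h} {u v : Vec A h} → odd-factor u ≡ odd-factor v → u ≡ v
    odd-factor-injective {u = []} {[]} _ = refl
    odd-factor-injective {u = a ∷ u} {b ∷ v} eq =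
      cong₂ _∷_ (c-injective (∷-injectiveˡ eq)) (odd-factor-injective (∷-injectiveʳ (∷-injectiveʳ eq)))

    odd-factor⁺-injective : ∀ {h} {u v : Vec A (suc h)} → odd-factor⁺ u ≡ odd-factor⁺ v → u ≡ v
    odd-factor⁺-injective {u = a ∷ u} {b ∷ v} eq =
      cong₂ _∷_ (c-injective (∷-injectiveˡ eq)) (even-factor-injective (∷-injectiveʳ eq))

    module _ (x : Word A) where

      complexity-interleave : ∀ {h h′ n m m′} (f : Vec A h → Vec B n) (f′ : Vec A h′ → Vec B n) →
        (∀ {u v} → f u ≡ f v → u ≡ v) → (∀ {u v} → f′ u ≡ f′ v → u ≡ v) →
        (∀ u v → f u ≢ f′ v) →
        (∀ k → window (interleave s c x) (double k) n ≡ f (window x k h)) →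
        (∀ k → window (interleave s c x) (suc (double k)) n ≡ f′ (window x k h′)) →
        Complexity x h m → Complexity x h′ m′ → Complexity (interleave s c x) n (m + m′)
      complexity-interleave {h} {h′} {n} f f′ f-inj f′-inj f≢f′ at-even at-odd
        (L , refl , L-unique , L-factors) (L′ , refl , L′-unique , L′-factors) =
        map f L ++ map f′ L′ ,
        trans (length-++ (map f L)) (cong₂ _+_ (length-map f L) (length-map f′ L′)) ,
        Unique.++⁺ (Unique.map⁺ f-inj L-unique) (Unique.map⁺ f′-inj L′-unique) disjoint ,
        λ w → listed w , occurs w
        where
        disjoint : ∀ {w} → ¬ (w ∈ map f L × w ∈ map f′ L′)
        disjoint (w∈ , w∈′) with ∈-map⁻ f w∈ | ∈-map⁻ f′ w∈′
        ... | u , _ , refl | v , _ , eq = f≢f′ u v eq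
        listed : ∀ w → IsFactor (interleave s c x) w → w ∈ map f L ++ map f′ L′
        listed w fac with IsFactor⇒window (interleave s c x) w fac
        ... | p , refl with parity p
        ...   | inj₁ (k , refl) = ∈-++⁺ˡ (subst (_∈ map f L) (sym (at-even k))
                  (∈-map⁺ f (proj₁ (L-factors _) (window-IsFactor x k h))))
        ...   | inj₂ (k , refl) = ∈-++⁺ʳ (map f L) (subst (_∈ map f′ L′) (sym (at-odd k))
                  (∈-map⁺ f′ (proj₁ (L′-factors _) (window-IsFactor x k h′))))
        occurs : ∀ w → w ∈ map f L ++ map f′ L′ → IsFactor (interleave s c x) w
        occurs w w∈ with ∈-++⁻ (map f L) w∈
        ... | inj₁ w∈f with ∈-map⁻ f w∈f
        ...   | u , u∈ , refl with IsFactor⇒window x u (proj₂ (L-factors u) u∈)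
        ...     | k , refl =
          subst (IsFactor (interleave s c x)) (at-even k) (window-IsFactor (interleave s c x) (double k) n)
        occurs w w∈ | inj₂ w∈f′ with ∈-map⁻ f′ w∈f′
        ...   | u , u∈ , refl with IsFactor⇒window x u (proj₂ (L′-factors u) u∈)
        ...     | k , refl =
          subst (IsFactor (interleave s c x)) (at-odd k) (window-IsFactor (interleave s c x) (suc (double k)) n)

      complexity-interleave-even : ∀ {h m} → Complexity x (suc h) m →
        Complexity (interleave s c x) (double (suc h)) (m + m)
      complexity-interleave-even {h} C =
        complexity-interleave even-factor odd-factor even-factor-injective odd-factor-injective
          (λ { (a ∷ u) (b ∷ v) eq → c≢s b (sym (∷-injectiveˡ eq)) })
          (λ k → window-interleave-even x k (suc h)) (λ k → window-interleave-odd x k (suc h)) C C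

      complexity-interleave-odd : ∀ {h m m′} → Complexity x h m → Complexity x (suc h) m′ →
        Complexity (interleave s c x) (suc (double h)) (m + m′)
      complexity-interleave-odd {h} =
        complexity-interleave ((s ∷_) ∘ odd-factor) odd-factor⁺
          (odd-factor-injective ∘ ∷-injectiveʳ) odd-factor⁺-injective
          (λ { u (b ∷ v) eq → c≢s b (sym (∷-injectiveˡ eq)) })
          (λ k → cong₂ _∷_ (interleave-double x k) (window-interleave-odd x k h))
          (λ k → cong₂ _∷_ (interleave-suc-double x k) (window-interleave-even x (suc k) h))

-- Replacing 00 by 020 in a σ-image

infixr 5 _∷ʷ_

_∷ʷ_ : {A : Set} → A → Word A → Word A
(a ∷ʷ w) zero = a
(a ∷ʷ w) (suc i) = w i

∷ʷ-cong : ∀ {A : Set} (a : A) {w w′ : Word A} → (∀ i → w i ≡ w′ i) →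
  ∀ i → (a ∷ʷ w) i ≡ (a ∷ʷ w′) i
∷ʷ-cong a eq zero = refl
∷ʷ-cong a eq (suc i) = eq i

module _ {A : Set} (f : ℕ → Block A) where

  flatten-one : ∀ {a} → f 0 ≡ one a → ∀ q → flatten f q ≡ (a ∷ʷ flatten (f ∘ suc)) q
  flatten-one eq zero rewrite eq = refl
  flatten-one eq (suc q) rewrite eq = refl

  flatten-two : ∀ {a b} → f 0 ≡ two a b → ∀ q → flatten f q ≡ (a ∷ʷ b ∷ʷ flatten (f ∘ suc)) q
  flatten-two eq zero rewrite eq = refl
  flatten-two eq (suc zero) rewrite eq = refl
  flatten-two eq (suc (suc q)) rewrite eq = refl

blocks : Word (Fin 2) → ℕ → Block (Fin 3)
blocks x i = blockM (x i) (x (suc i))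

-- Replacing 00 by 020 turns the block σ (y 0) = 01 into 0 1, and the block σ (y 0) = 0,
-- always followed by a 0, into 0 2.
flatten-blocks-head : ∀ {x y} → σ-Image x y → ∀ q →
  flatten (blocks x) q ≡ (f0 ∷ʷ fs (y 0) ∷ʷ flatten (blocks (λ i → x (length (σ (y 0)) + i)))) q
flatten-blocks-head {x} {y} image with y 0 | image 0 | image 1
... | f0 | x₀ , x₁ , _ | _ = λ q →
  trans (flatten-one (blocks x) (cong₂ blockM x₀ x₁) q)
        (∷ʷ-cong f0 (flatten-one (blocks x ∘ suc) (cong (λ a → blockM a (x 2)) x₁)) q)
... | fs f0 | x₀ , _ | occ₁ = flatten-two (blocks x) (cong₂ blockM x₀ (σ-head _ occ₁))

flatten-blocks : ∀ {x y} → σ-Image x y → ∀ q → flatten (blocks x) q ≡ interleave f0 fs y q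
flatten-blocks image zero = flatten-blocks-head image 0
flatten-blocks image (suc zero) = flatten-blocks-head image 1
flatten-blocks image (suc (suc q)) =
  trans (flatten-blocks-head image (suc (suc q))) (flatten-blocks (σ-Image-tail image) q)

-- Comparing with multiples of φ

infix 4 _<φ_ _>φ_

-- t <φ k and t >φ k say t < φk and t > φk; as φ² = φ + 1, for k > 0 these are t² < tk + k²
-- and its reverse. Records, unlike the bare inequalities, let t and k be inferred.
record _<φ_ (t k : ℕ) : Set where
  constructor mk<φ
  field unwrap : t * t < t * k + k * k

record _>φ_ (t k : ℕ) : Set where
  constructor mk>φ
  field unwrap : t * k + k * k < t * t

<φ-asym : ∀ {t k} → t <φ k → ¬ t >φ k
<φ-asym (mk<φ lt) (mk>φ gt) = <-asym lt gt

<-balance : ∀ {a b c d} → a + b ≡ c + d → b < d → c < a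
<-balance {a} {b} {c} {d} eq b<d with c <? a
... | yes c<a = c<a
... | no c≮a = ⊥-elim (<-irrefl eq (+-mono-≤-< (≮⇒≥ c≮a) b<d))

<-balance⁻ : ∀ {a b c d} → a + b ≡ c + d → c < a → b < d
<-balance⁻ {a} {b} {c} {d} eq = <-balance (trans (+-comm d c) (trans (sym eq) (+-comm a b)))

-- x ↦ 1 + 1/x fixes φ and reverses order, so (t + k)/t and t/k lie on opposite sides of φ.
φ-reciprocal-identity : ∀ t k → (t + k) * (t + k) + t * t ≡ ((t + k) * t + t * t) + (t * k + k * k)
φ-reciprocal-identity = solve-∀

<φ⇒+>φ : ∀ {t k} → t <φ k → t + k >φ t
<φ⇒+>φ {t} {k} (mk<φ lt) = mk>φ (<-balance (φ-reciprocal-identity t k) lt)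

+>φ⇒<φ : ∀ {t k} → t + k >φ t → t <φ k
+>φ⇒<φ {t} {k} (mk>φ gt) = mk<φ (<-balance⁻ (φ-reciprocal-identity t k) gt)

>φ⇒+<φ : ∀ {t k} → t >φ k → t + k <φ t
>φ⇒+<φ {t} {k} (mk>φ gt) = mk<φ (<-balance (sym (φ-reciprocal-identity t k)) gt)

+<φ⇒>φ : ∀ {t k} → t + k <φ t → t >φ k
+<φ⇒>φ {t} {k} (mk<φ lt) = mk>φ (<-balance⁻ (sym (φ-reciprocal-identity t k)) lt)

*0+0≡0 : ∀ t → t * 0 + 0 * 0 ≡ 0
*0+0≡0 t = trans (+-identityʳ (t * 0)) (*-zeroʳ t)

-- Descent: a solution (t, k) with k > 0 yields the smaller solution (k, t − k).
φ-irrational : ∀ t k → t * t ≡ t * k + k * k → k ≡ 0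
φ-irrational t k = <-rec (λ k → ∀ t → t * t ≡ t * k + k * k → k ≡ 0) descent k t
  where
  descent : ∀ k → (∀ {j} → j < k → ∀ t → t * t ≡ t * j + j * j → j ≡ 0) →
    ∀ t → t * t ≡ t * k + k * k → k ≡ 0
  descent zero _ _ _ = refl
  descent k@(suc k′) smaller t eq with t ≤? k
  ... | yes t≤k = ⊥-elim (<-irrefl eq (≤-<-trans (*-monoʳ-≤ t t≤k) (m<m+n (t * k) (s≤s z≤n))))
  ... | no t≰k = ⊥-elim (0≢1+n (sym k²≡0))
    where
    s = t ∸ k
    t≡k+s : k + s ≡ t
    t≡k+s = m+[n∸m]≡n (≰⇒≥ t≰k)
    eq′ : k * k ≡ k * s + s * s
    eq′ = +-cancelˡ-≡ ((k + s) * k + k * k) (k * k) (k * s + s * s) (begin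
      ((k + s) * k + k * k) + k * k ≡⟨ cong (_+ k * k) (subst (λ u → u * u ≡ u * k + k * k) (sym t≡k+s) eq) ⟨
      (k + s) * (k + s) + k * k     ≡⟨ φ-reciprocal-identity k s ⟩
      ((k + s) * k + k * k) + (k * s + s * s) ∎)
      where open ≡-Reasoning
    s<k : s < k
    s<k with s <? k
    ... | yes s<k = s<k
    ... | no s≮k = ⊥-elim (<-irrefl eq′ (≤-<-trans (≤-reflexive (sym (+-identityʳ (k * k))))
            (+-mono-≤-< (*-monoʳ-≤ k k≤s) (≤-trans (s≤s z≤n) (*-mono-≤ k≤s k≤s)))))
      where
      k≤s = ≮⇒≥ s≮k
    k²≡0 : k * k ≡ 0
    k²≡0 = begin
      k * k         ≡⟨ eq′ ⟩
      k * s + s * s ≡⟨ cong (λ j → k * j + j * j) (smaller s<k k eq′) ⟩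
      k * 0 + 0 * 0 ≡⟨ *0+0≡0 k ⟩
      0             ∎
      where open ≡-Reasoning

<φ-or->φ : ∀ t k → t <φ suc k ⊎ t >φ suc k
<φ-or->φ t k with <-cmp (t * t) (t * suc k + suc k * suc k)
... | tri< lt _ _ = inj₁ (mk<φ lt)
... | tri≈ _ eq _ = ⊥-elim (0≢1+n (sym (φ-irrational t (suc k) eq)))
... | tri> _ _ gt = inj₂ (mk>φ gt)

¬<φ0 : ∀ {t} → ¬ t <φ 0
¬<φ0 {t} (mk<φ lt) = n≮0 (subst (t * t <_) (*0+0≡0 t) lt)

>φ⇒> : ∀ {t k} → t >φ k → k < t
>φ⇒> {t} {k} (mk>φ gt) with k <? t
... | yes k<t = k<t
... | no k≮t = ⊥-elim (<-irrefl refl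
  (<-≤-trans gt (≤-trans (*-monoʳ-≤ t (≮⇒≥ k≮t)) (m≤m+n (t * k) (k * k)))))

<φ⇒<2* : ∀ {t k} → t <φ k → t < 2 * k
<φ⇒<2* {t} {k} (mk<φ lt) with t <? 2 * k
... | yes t<2k = t<2k
... | no t≮2k = ⊥-elim (<-irrefl refl (<-≤-trans lt (begin
    t * k + k * k ≤⟨ +-monoʳ-≤ (t * k) (*-monoˡ-≤ k (≤-trans (m≤m+n k (k + 0)) (≮⇒≥ t≮2k))) ⟩
    t * k + t * k ≡⟨ solve t k ⟩
    t * (2 * k)   ≤⟨ *-monoʳ-≤ t (≮⇒≥ t≮2k) ⟩
    t * t         ∎)))
  where
  open ≤-Reasoning
  solve : ∀ t k → t * k + t * k ≡ t * (2 * k)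
  solve = solve-∀

<φ-suc : ∀ {t k} → t <φ k → suc t <φ suc k
<φ-suc {t} {k} (mk<φ lt) = mk<φ (subst₂ _<_ (lhs t) (rhs t k)
  (+-mono-<-≤ lt (+-monoʳ-≤ t (≤-trans (<φ⇒<2* (mk<φ lt)) (m≤m+n (2 * k) (k + 2))))))
  where
  lhs : ∀ t → t * t + (t + suc t) ≡ suc t * suc t
  lhs = solve-∀
  rhs : ∀ t k → (t * k + k * k) + (t + (2 * k + (k + 2))) ≡ suc t * suc k + suc k * suc k
  rhs = solve-∀

>φ-pred : ∀ {t k} → suc t >φ suc k → t >φ k
>φ-pred {zero} (mk>φ (s≤s ()))
>φ-pred {suc t} {zero} _ = mk>φ (subst (_< suc t * suc t) (sym (*0+0≡0 (suc t))) (s≤s z≤n))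
>φ-pred {t} {suc k} gt with <φ-or->φ t k
... | inj₁ lt = ⊥-elim (<φ-asym (<φ-suc lt) gt)
... | inj₂ gt′ = gt′

>φ-sucˡ : ∀ {t k} → t >φ k → suc t >φ k
>φ-sucˡ {t} {k} (mk>φ gt) = mk>φ (subst₂ _<_ (lhs t k) (rhs t)
  (+-mono-<-≤ gt (≤-trans (<⇒≤ (>φ⇒> (mk>φ gt))) (m≤m+n t (suc t)))))
  where
  lhs : ∀ t k → (t * k + k * k) + k ≡ suc t * k + k * k
  lhs = solve-∀
  rhs : ∀ t → t * t + (t + suc t) ≡ suc t * suc t
  rhs = solve-∀

>φ-monoˡ : ∀ {m t k} → m ≤ t → m >φ k → t >φ k
>φ-monoˡ {m} {t} {k} m≤t gt = go (≤⇒≤′ m≤t)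
  where
  go : ∀ {t} → m ≤′ t → t >φ k
  go ≤′-refl = gt
  go (≤′-step m≤′t) = >φ-sucˡ (go m≤′t)

<φ-antimonoˡ : ∀ {m t k} → m ≤ t → t <φ k → m <φ k
<φ-antimonoˡ {k = zero} _ lt = ⊥-elim (¬<φ0 lt)
<φ-antimonoˡ {m} {k = suc k} m≤t lt with <φ-or->φ m k
... | inj₁ lt′ = lt′
... | inj₂ gt = ⊥-elim (<φ-asym lt (>φ-monoˡ m≤t gt))

-- 1/φ < 3/4
>φ⇒4k≤3t+1 : ∀ {t k} → t >φ k → 4 * k ≤ 3 * t + 1
>φ⇒4k≤3t+1 {t} {k} (mk>φ gt) with 4 * k ≤? 3 * t + 1
... | yes bound = bound
... | no unbounded = ⊥-elim (<⇒≱ gt (*-cancelˡ-≤ 9 (begin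
    9 * (t * t)               ≡⟨ i₁ t ⟩
    (3 * t) * (3 * t)         ≤⟨ *-monoʳ-≤ (3 * t) 3t≤4k ⟩
    (3 * t) * (4 * k)         ≡⟨ i₂ t k ⟩
    9 * (t * k) + (3 * t) * k ≤⟨ +-monoʳ-≤ (9 * (t * k)) (*-monoˡ-≤ k 3t≤4k) ⟩
    9 * (t * k) + (4 * k) * k ≡⟨ i₃ t k ⟩
    9 * (t * k) + 4 * (k * k) ≤⟨ +-monoʳ-≤ (9 * (t * k)) (*-monoˡ-≤ (k * k) (m≤m+n 4 5)) ⟩
    9 * (t * k) + 9 * (k * k) ≡⟨ i₄ t k ⟩
    9 * (t * k + k * k)       ∎)))
  where
  open ≤-Reasoning
  3t≤4k : 3 * t ≤ 4 * k
  3t≤4k = ≤-trans (m≤m+n (3 * t) 1) (<⇒≤ (≰⇒> unbounded))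
  i₁ : ∀ t → 9 * (t * t) ≡ (3 * t) * (3 * t)
  i₁ = solve-∀
  i₂ : ∀ t k → (3 * t) * (4 * k) ≡ 9 * (t * k) + (3 * t) * k
  i₂ = solve-∀
  i₃ : ∀ t k → 9 * (t * k) + (4 * k) * k ≡ 9 * (t * k) + 4 * (k * k)
  i₃ = solve-∀
  i₄ : ∀ t k → 9 * (t * k) + 9 * (k * k) ≡ 9 * (t * k + k * k)
  i₄ = solve-∀

>φ-2+ : ∀ {t k} → t >φ k → suc (suc t) >φ suc k
>φ-2+ {t} {k} (mk>φ gt) = mk>φ (subst₂ _<_ (lhs t k) (rhs t)
  (+-mono-<-≤ gt (+-monoˡ-≤ 3 (+-monoʳ-≤ t (>φ⇒4k≤3t+1 {t} {k} (mk>φ gt))))))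
  where
  lhs : ∀ t k → (t * k + k * k) + (t + 4 * k + 3) ≡ suc (suc t) * suc k + suc k * suc k
  lhs = solve-∀
  rhs : ∀ t → t * t + (t + (3 * t + 1) + 3) ≡ suc (suc t) * suc (suc t)
  rhs = solve-∀

ltPhi-identity : ∀ m k d → k + d ≡ 2 * m → 4 * (m * m) + 5 * (k * k) ≡ 4 * (m * k + k * k) + d * d
ltPhi-identity m k d k+d≡2m = begin
  4 * (m * m) + 5 * (k * k)              ≡⟨ i₁ m k ⟩
  (2 * m) * (2 * m) + 5 * (k * k)        ≡⟨ cong (λ e → e * e + 5 * (k * k)) (sym k+d≡2m) ⟩
  (k + d) * (k + d) + 5 * (k * k)        ≡⟨ i₂ k d ⟩
  (2 * k) * (k + d) + 4 * (k * k) + d * d ≡⟨ cong (λ e → (2 * k) * e + 4 * (k * k) + d * d) k+d≡2m ⟩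
  (2 * k) * (2 * m) + 4 * (k * k) + d * d ≡⟨ i₃ m k d ⟩
  4 * (m * k + k * k) + d * d            ∎
  where
  open ≡-Reasoning
  i₁ : ∀ m k → 4 * (m * m) + 5 * (k * k) ≡ (2 * m) * (2 * m) + 5 * (k * k)
  i₁ = solve-∀
  i₂ : ∀ k d → (k + d) * (k + d) + 5 * (k * k) ≡ (2 * k) * (k + d) + 4 * (k * k) + d * d
  i₂ = solve-∀
  i₃ : ∀ m k d → (2 * k) * (2 * m) + 4 * (k * k) + d * d ≡ 4 * (m * k + k * k) + d * d
  i₃ = solve-∀

ltPhi⇒<φ : ∀ m k → T (ltPhi m k) → m <φ k
ltPhi⇒<φ m k holds with 2 * m ≤? k
... | yes 2m≤k rewrite m≤n⇒m∸n≡0 2m≤k with k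
...   | zero = ⊥-elim holds
...   | suc k′ = mk<φ (≤-<-trans (*-monoʳ-≤ m (≤-trans (m≤m+n m (m + 0)) 2m≤k))
                   (m<m+n (m * suc k′) (s≤s z≤n)))
ltPhi⇒<φ m k holds | no 2m≰k = mk<φ (*-cancelˡ-< 4 (m * m) (m * k + k * k)
  (<-balance (sym (ltPhi-identity m k d k+d≡2m)) (<ᵇ⇒< (d * d) (5 * (k * k)) holds)))
  where
  d = 2 * m ∸ k
  k+d≡2m : k + d ≡ 2 * m
  k+d≡2m = m+[n∸m]≡n (<⇒≤ (≰⇒> 2m≰k))

<φ⇒ltPhi : ∀ m k → m <φ k → T (ltPhi m k)
<φ⇒ltPhi m zero lt = ⊥-elim (¬<φ0 lt)
<φ⇒ltPhi m (suc k′) (mk<φ lt) with 2 * m ≤? suc k′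
... | yes 2m≤k rewrite m≤n⇒m∸n≡0 2m≤k = tt
... | no 2m≰k = <⇒<ᵇ (<-balance⁻ (sym (ltPhi-identity m k d k+d≡2m)) (*-monoʳ-< 4 lt))
  where
  k = suc k′
  d = 2 * m ∸ k
  k+d≡2m : k + d ≡ 2 * m
  k+d≡2m = m+[n∸m]≡n (<⇒≤ (≰⇒> 2m≰k))

length-filterᵇ-applyUpTo : ∀ (P : ℕ → Bool) f n c → c ≤ n →
  (∀ i → i < n → (T (P (f i)) → i < c) × (i < c → T (P (f i)))) →
  length (filterᵇ P (applyUpTo f n)) ≡ c
length-filterᵇ-applyUpTo P f zero zero _ _ = refl
length-filterᵇ-applyUpTo P f (suc n) c c≤n counts with P (f 0) in eq
... | true with c
...   | zero = ⊥-elim (n≮0 (proj₁ (counts 0 (s≤s z≤n)) (subst T (sym eq) tt)))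
...   | suc c′ = cong suc (length-filterᵇ-applyUpTo P (f ∘ suc) n c′ (≤-pred c≤n)
         (λ i i<n → ≤-pred ∘ proj₁ (counts (suc i) (s≤s i<n)) , proj₂ (counts (suc i) (s≤s i<n)) ∘ s≤s))
length-filterᵇ-applyUpTo P f (suc n) c c≤n counts | false with c
...   | zero = length-filterᵇ-applyUpTo P (f ∘ suc) n zero z≤n
         (λ i i<n → ⊥-elim ∘ n≮0 ∘ proj₁ (counts (suc i) (s≤s i<n)) , λ ())
...   | suc c′ = ⊥-elim (subst T eq (proj₂ (counts 0 (s≤s z≤n)) (s≤s z≤n)))

below-unique : ∀ {t k} → t <φ k → suc t >φ k → below k ≡ t
below-unique {t} {k} lt gt =
  length-filterᵇ-applyUpTo (λ m → ltPhi m k) suc (2 * k) t (<⇒≤ (<φ⇒<2* lt)) counts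
  where
  counts : ∀ i → i < 2 * k → (T (ltPhi (suc i) k) → i < t) × (i < t → T (ltPhi (suc i) k))
  counts i _ = below-t , λ i<t → <φ⇒ltPhi (suc i) k (<φ-antimonoˡ i<t lt)
    where
    below-t : T (ltPhi (suc i) k) → i < t
    below-t holds with i <? t
    ... | yes i<t = i<t
    ... | no i≮t = ⊥-elim (<φ-asym (ltPhi⇒<φ (suc i) k holds) (>φ-monoˡ (s≤s (≮⇒≥ i≮t)) gt))

crossing : (P : ℕ → Set) → Decidable P → ∀ N → P 0 → ¬ P N → ∃ λ t → P t × ¬ P (suc t)
crossing P P? zero p₀ ¬p = ⊥-elim (¬p p₀)
crossing P P? (suc N) p₀ ¬p with P? N
... | yes p = N , p , ¬p
... | no ¬p′ = crossing P P? N p₀ ¬p′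

below-spec : ∀ k → below (suc k) <φ suc k × suc (below (suc k)) >φ suc k
below-spec k with crossing (_<φ suc k) (λ t → map′ mk<φ _<φ_.unwrap (t * t <? t * suc k + suc k * suc k))
  (2 * suc k) (mk<φ (s≤s z≤n)) (λ lt → <-irrefl refl (<φ⇒<2* lt))
... | t , lt , ¬lt with <φ-or->φ (suc t) k
...   | inj₁ lt′ = ⊥-elim (¬lt lt′)
...   | inj₂ gt rewrite below-unique lt gt = lt , gt

below-gap : ∀ n → below (suc (suc n)) ≡ suc (below (suc n)) ⊎ below (suc (suc n)) ≡ suc (suc (below (suc n)))
below-gap n with below-spec n | <φ-or->φ (suc (suc (below (suc n)))) (suc n)
... | lt , gt | inj₁ lt₂ = inj₂ (below-unique lt₂ (>φ-2+ gt))
... | lt , gt | inj₂ gt₂ = inj₁ (below-unique (<φ-suc lt) gt₂)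

-- n = k + ⌊kφ⌋ = ⌊kφ²⌋ for some k ≥ 1.
InBeattyφ² : ℕ → Set
InBeattyφ² n = ∃ λ k → below (suc k) + suc k ≡ n

-- For n = K + k with K = ⌊kφ⌋, the map (t, k) ↦ (2t + k, t + k) keeps t on its side of kφ,
-- so ⌊nφ⌋ = 2K + k and ⌊(n + 1)φ⌋ = 2K + k + 1.
Beatty⇒below-gap₁ : ∀ {n} → InBeattyφ² n → below (suc n) ≡ suc (below n)
Beatty⇒below-gap₁ (k , refl) with below-spec k
... | lK , gK = trans (below-unique (<φ-suc lt) gt) (cong suc (sym (below-unique lt (>φ-pred gt))))
  where
  K = below (suc k)
  lt : (K + suc k) + K <φ K + suc k
  lt = >φ⇒+<φ (<φ⇒+>φ lK)
  gt : suc (suc ((K + suc k) + K)) >φ suc (K + suc k)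
  gt = subst (_>φ suc (K + suc k)) (cong suc (+-suc (K + suc k) K)) (<φ⇒+>φ (>φ⇒+<φ gK))

-- Conversely, k = n − c with c = ⌊nφ⌋ − n has ⌊kφ⌋ = c when ⌊(n + 1)φ⌋ = ⌊nφ⌋ + 1.
below-gap₁⇒Beatty : ∀ n → below (suc (suc n)) ≡ suc (below (suc n)) → InBeattyφ² (suc n)
below-gap₁⇒Beatty n gap₁ with below-spec n | below-spec (suc n)
... | lt , gt | _ , gt₂ = k₀ , (begin
  below (suc k₀) + suc k₀ ≡⟨ cong (_+ suc k₀) (below-unique lc gc) ⟩
  c + suc k₀              ≡⟨ c+k≡N ⟩
  suc n                   ∎)
  where
  open ≡-Reasoning
  N = suc n
  A = below N
  N≤A : N ≤ A
  N≤A = ≤-pred (>φ⇒> gt)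
  c = A ∸ N
  N+c≡A : N + c ≡ A
  N+c≡A = m+[n∸m]≡n N≤A
  c<N : c < N
  c<N = +-cancelˡ-< N c N (subst (_< N + N) (sym N+c≡A) (subst (A <_) (cong (N +_) (+-identityʳ N)) (<φ⇒<2* lt)))
  k₀ = n ∸ c
  c+k≡N : c + suc k₀ ≡ N
  c+k≡N = trans (+-suc c k₀) (cong suc (m+[n∸m]≡n (≤-pred c<N)))
  A≡c+k+c : A ≡ (c + suc k₀) + c
  A≡c+k+c = trans (sym N+c≡A) (cong (_+ c) (sym c+k≡N))
  lc : c <φ suc k₀
  lc = +>φ⇒<φ (+<φ⇒>φ (subst₂ _<φ_ A≡c+k+c (sym c+k≡N) lt))
  gc : suc c >φ suc k₀
  gc = +<φ⇒>φ (+>φ⇒<φ (subst₂ _>φ_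
    (trans (cong (suc ∘ suc) A≡c+k+c) (cong suc (sym (+-suc (c + suc k₀) c))))
    (cong suc (sym c+k≡N)) (subst (λ a → suc a >φ suc N) gap₁ gt₂)))

below-below : ∀ n → below (below (suc n)) ≡ below (suc n) + n
below-below n with below-spec n
... | lt , gt = below-unique (>φ⇒+<φ (>φ-pred gt))
  (subst (_>φ below (suc n)) (+-suc (below (suc n)) n) (<φ⇒+>φ lt))

below-suc-below : ∀ n → below (suc (below (suc n))) ≡ suc (below (suc n) + suc n)
below-suc-below n with below-spec n
... | lt , gt = below-unique (>φ⇒+<φ gt)
  (subst (_>φ suc A) (cong suc (+-suc A (suc n))) (<φ⇒+>φ (<φ-suc lt)))
  where A = below (suc n)

below-2+below : ∀ n → below (suc (suc n)) ≡ suc (suc (below (suc n))) →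
  below (suc (suc (below (suc n)))) ≡ suc (suc (below (suc n) + suc n))
below-2+below n gap₂ with below-spec (suc n)
... | lt₂ , gt₂ rewrite gap₂ = below-unique (>φ⇒+<φ (>φ-pred gt₂))
  (subst (_>φ suc (suc A)) (cong (suc ∘ suc) (+-suc A (suc n))) (<φ⇒+>φ lt₂))
  where A = below (suc n)

-- The Fibonacci word is fixed by σ

fibonacciWord≡1⇒Beatty : ∀ p → fibonacciWord p ≡ fs f0 → InBeattyφ² (suc p)
fibonacciWord≡1⇒Beatty p F≡1 with any (λ k → p ≡ᵇ (k ∸ 1 + below k)) (applyUpTo suc (suc p)) in found
... | false = ⊥-elim (Fin.0≢1+n F≡1)
... | true with applyUpTo⁻ suc
  (any⁻ (λ k → p ≡ᵇ (k ∸ 1 + below k)) (applyUpTo suc (suc p)) (subst T (sym found) tt))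
...   | i , _ , hit = i , trans (+-comm (below (suc i)) (suc i)) (cong suc (sym (≡ᵇ⇒≡ p (i + below (suc i)) hit)))

Beatty⇒fibonacciWord≡1 : ∀ p → InBeattyφ² (suc p) → fibonacciWord p ≡ fs f0
Beatty⇒fibonacciWord≡1 p (i , hit) with any (λ k → p ≡ᵇ (k ∸ 1 + below k)) (applyUpTo suc (suc p)) in found
... | true = refl
... | false = ⊥-elim (subst T found (any⁺ _ (applyUpTo⁺ suc (≡⇒≡ᵇ p (i + below (suc i)) p≡) (s≤s i≤p))))
  where
  p≡ : p ≡ i + below (suc i)
  p≡ = sym (suc-injective (trans (+-comm (suc i) (below (suc i))) hit))
  i≤p : i ≤ p
  i≤p = ≤-trans (m≤m+n i (below (suc i))) (≤-reflexive (sym p≡))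

σ-length-injective : ∀ {a b} → length (σ a) ≡ length (σ b) → a ≡ b
σ-length-injective {f0} {f0} _ = refl
σ-length-injective {fs f0} {fs f0} _ = refl

fibonacciWord-gap : ∀ p → below (suc (suc p)) ≡ length (σ (fibonacciWord p)) + below (suc p)
fibonacciWord-gap p with fibonacciWord p in F
... | fs f0 = Beatty⇒below-gap₁ (fibonacciWord≡1⇒Beatty p F)
... | f0 with below-gap p
...   | inj₂ gap₂ = gap₂
...   | inj₁ gap₁ =
  ⊥-elim (Fin.0≢1+n (trans (sym F) (Beatty⇒fibonacciWord≡1 p (below-gap₁⇒Beatty p gap₁))))

fibonacciWord-from-gap : ∀ p a → below (suc (suc p)) ≡ length (σ a) + below (suc p) → fibonacciWord p ≡ a
fibonacciWord-from-gap p a gap =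
  σ-length-injective (+-cancelʳ-≡ (below (suc p)) (length (σ (fibonacciWord p))) (length (σ a))
    (trans (sym (fibonacciWord-gap p)) gap))

σ-start-below : ∀ k → suc (σ-start fibonacciWord k) ≡ below (suc k)
σ-start-below zero = refl
σ-start-below (suc k) = begin
  suc (ℓ + σ-start fibonacciWord k) ≡⟨ +-suc ℓ (σ-start fibonacciWord k) ⟨
  ℓ + suc (σ-start fibonacciWord k) ≡⟨ cong (ℓ +_) (σ-start-below k) ⟩
  ℓ + below (suc k)                 ≡⟨ fibonacciWord-gap k ⟨
  below (suc (suc k))               ∎
  where
  open ≡-Reasoning
  ℓ = length (σ (fibonacciWord k))

fibonacciWord-at-σ-start : ∀ k → fibonacciWord (σ-start fibonacciWord k) ≡ f0
fibonacciWord-at-σ-start k = fibonacciWord-from-gap (σ-start fibonacciWord k) f0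
  (subst (λ m → below (suc m) ≡ suc (suc (below m))) (sym (σ-start-below k))
    (trans (below-suc-below k) (cong suc (trans (+-suc A k) (cong suc (sym (below-below k)))))))
  where A = below (suc k)

fibonacciWord-after-σ-start : ∀ k → fibonacciWord k ≡ f0 →
  fibonacciWord (suc (σ-start fibonacciWord k)) ≡ fs f0
fibonacciWord-after-σ-start k F = fibonacciWord-from-gap (suc (σ-start fibonacciWord k)) (fs f0)
  (subst (λ m → below (suc (suc m)) ≡ suc (below (suc m))) (sym (σ-start-below k))
    (trans (below-2+below k gap₂) (cong suc (sym (below-suc-below k)))))
  where
  gap₂ : below (suc (suc k)) ≡ suc (suc (below (suc k)))
  gap₂ = trans (fibonacciWord-gap k) (cong (λ a → length (σ a) + below (suc k)) F)

fibonacciWord-σ-fixed : σ-Image fibonacciWord fibonacciWord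
fibonacciWord-σ-fixed k with fibonacciWord k in F
... | f0 = fibonacciWord-at-σ-start k , fibonacciWord-after-σ-start k F , tt
... | fs f0 = fibonacciWord-at-σ-start k , tt

SM≗interleave : ∀ q → interleave f0 fs fibonacciWord q ≡ SM q
SM≗interleave q = sym (flatten-blocks fibonacciWord-σ-fixed q)

fibonacciWord-complexity : ∀ h → Complexity fibonacciWord h (suc h)
fibonacciWord-complexity = σ-fixed-complexity fibonacciWord fibonacciWord-σ-fixed

SM-complexity-even : ∀ h → Complexity SM (double (suc h)) (double (suc h) + 2)
SM-complexity-even h = subst (Complexity SM _) (+-double (suc h))
  (Complexity-cong SM≗interleave
    (complexity-interleave-even f0 fs Fin.suc-injective (λ _ ()) fibonacciWord
      (fibonacciWord-complexity (suc h))))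

SM-complexity-odd : ∀ h → Complexity SM (suc (double h)) (suc (double h) + 2)
SM-complexity-odd h = subst (Complexity SM _) (trans (+-suc (suc h) (suc h)) (cong suc (+-double h)))
  (Complexity-cong SM≗interleave
    (complexity-interleave-odd f0 fs Fin.suc-injective (λ _ ()) fibonacciWord
      (fibonacciWord-complexity h) (fibonacciWord-complexity (suc h))))

theorem4p2 : (n : ℕ) → Complexity SM (suc n) (suc n + 2)
theorem4p2 n with parity (suc n)
... | inj₁ (suc h , eq) = subst (λ m → Complexity SM m (m + 2)) (sym eq) (SM-complexity-even h)
... | inj₂ (h , eq) = subst (λ m → Complexity SM m (m + 2)) (sym eq) (SM-complexity-odd h)
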